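{- $\mu(n)\in\Omega(\log\log n)$ as $n\to\infty$.
   Context: A matroid on a finite set $S$ is a family $\mathcal{M}$ of subsets of $S$ with $\emptyset\in\mathcal{M}$, closed under subsets, such that for every $A\subseteq S$ all maximal members of $\mathcal{M}$ contained in $A$ have the same cardinality. For a finite simple graph $G=(V,E)$, $M(G)$ is the family of all matchings (sets of pairwise disjoint edges) of $G$, and $\mu(G)$ is the minimum $m\in\mathbb{N}$ such that $M(G)$ is the intersection $\mathcal{M}_1\cap\dots\cap\mathcal{M}_m$ of $m$ matroids on $E$. For $n\in\mathbb{N}$, $\mu(n)=\max\{\mu(G): G \text{ a finite simple graph with } |V|\le n\}$. -}

module Defs where

open import Level using (0ℓ)
open import Data.Nat using (ℕ; _<_; _≤_; _*_)
open import Data.Nat.Logarithm using (⌊log₂_⌋)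
open import Data.Fin using (Fin)
open import Data.Fin.Subset using (Subset; _∈_; _⊆_; ∣_∣) renaming (⊥ to ∅)
open import Data.Product using (Σ; _×_; ∃-syntax)
open import Data.Vec.Functional using (Vector)
open import Function.Definitions using (Injective)
open import Relation.Binary.PropositionalEquality using (_≡_; _≢_)
open import Relation.Nullary using (¬_)

-- Its edge set is Fin m;
-- edge e joins the vertices (tail e) and (head e) with tail e < head e
-- (so no loops, and each unordered pair is represented uniquely), and
-- distinct edges have distinct endpoint pairs (no multi-edges).
record Graph (v : ℕ) : Set where
  field
    m     : ℕ
    tail  : Fin m → Fin v
    head  : Fin m → Fin v
    ordered : ∀ e → Data.Fin._<_ (tail e) (head e)
    simple  : ∀ e f → tail e ≡ tail f → head e ≡ head f → e ≡ f

open Graph public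

Family : ℕ → Set₁
Family k = Subset k → Set

IsMaximalIn : ∀ {k} → Family k → Subset k → Subset k → Set
IsMaximalIn 𝓜 A X = X ⊆ A × 𝓜 X × (∀ Y → X ⊆ Y → Y ⊆ A → 𝓜 Y → Y ⊆ X)

record IsMatroid {k : ℕ} (𝓜 : Family k) : Set where
  field
    empty∈   : 𝓜 ∅
    down     : ∀ X Y → X ⊆ Y → 𝓜 Y → 𝓜 X
    equicard : ∀ A X Y → IsMaximalIn 𝓜 A X → IsMaximalIn 𝓜 A Y → ∣ X ∣ ≡ ∣ Y ∣

Disjoint : ∀ {v} (G : Graph v) → Fin (m G) → Fin (m G) → Set
Disjoint G e f =
  tail G e ≢ tail G f × tail G e ≢ head G f ×
  head G e ≢ tail G f × head G e ≢ head G f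

Matching : ∀ {v} (G : Graph v) → Family (m G)
Matching G X = ∀ e f → e ∈ X → f ∈ X → e ≢ f → Disjoint G e f

IntersectionOf : ∀ {v} (G : Graph v) → ℕ → Set₁
IntersectionOf G r =
  Σ (Vector (Family (m G)) r) λ 𝓜s →
    (∀ i → IsMatroid (𝓜s i)) ×
    (∀ X → (Matching G X → ∀ i → 𝓜s i X) × ((∀ i → 𝓜s i X) → Matching G X))

-- μ(G) ≥ k  :⇔  M(G) is not an intersection of fewer than k matroids.
μG≥ : ∀ {v} → Graph v → ℕ → Set₁
μG≥ G k = ∀ r → r < k → ¬ IntersectionOf G r

-- μ(n) ≥ k  :⇔  some simple graph with at most n vertices has μ(G) ≥ k.
μ≥ : ℕ → ℕ → Set₁
μ≥ n k = ∃[ v ] (v ≤ n × Σ (Graph v) λ G → μG≥ G k)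

-- In K_n, a matroid containing every matching cannot reject both paths
-- {ab, bc} and {bc, cd} for a < b < c < d: the independent sets {bc} and
-- {ab, cd} would then both be maximal in {ab, bc, cd}.  Since each path
-- {ab, bc} is rejected by one of the r matroids, this colours the 2-paths of
-- the transitive tournament on n vertices with r colours, no colour class
-- containing two consecutive paths.  Sending c to the down-closed family
-- generated by the colour sets S(b, c) = {i | some a < b has abc of colour i},
-- b < c, is injective (S(c, d) lies in the family of d but not in that of c),
-- so n ≤ 2 ^ 2 ^ r, i.e. μ(K_n) > ⌊log₂ ⌊log₂ n⌋⌋.

module Submission where

open import Defs
open import Data.Nat using (ℕ; _≤_; _*_)
open import Data.Nat.Logarithm using (⌊log₂_⌋)
open import Data.Product using (_×_; ∃-syntax)

open import Data.Nat as ℕ using (zero; suc; _+_; _^_; z<s; s<s)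
open import Data.Nat.Logarithm using (⌊log₂⌋-mono-≤; ⌊log₂[2^n]⌋≡n)
import Data.Nat.Properties as ℕ
open import Data.Fin as F using (Fin; zero; suc; splitAt; _↑ˡ_; _↑ʳ_; funToFin; finToFun)
open import Data.Fin.Properties as F
  using (splitAt-↑ˡ; splitAt-↑ʳ; splitAt⁻¹-↑ˡ; splitAt⁻¹-↑ʳ; <-irrelevant; <-cmp; _<?_;
         _≟_; <⇒≢; any?; all?; ¬∀⟶∃¬; injective⇒≤; finToFun-funToFin; sequence)
open import Data.Fin.Subset using (Subset; _∈_; _⊆_; ∣_∣; ⁅_⁆; _∪_)
open import Data.Fin.Subset.Properties using (x∈⁅x⁆; x∈⁅y⁆⇒x≡y; x∈p∪q⁻; x∈p∪q⁺; ∪-comm; ∣⁅x⁆∣≡1; p⊂q⇒∣p∣<∣q∣)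
open import Data.Product using (_,_; proj₁; proj₂)
open import Data.Sum using (_⊎_; inj₁; inj₂; [_,_]′; map₂)
open import Effect.Monad using (RawMonad)
open import Function using (_∘_; id; const)
open import Function.Definitions using (Injective)
open import Relation.Binary.Definitions using (tri<; tri≈; tri>)
open import Relation.Binary.PropositionalEquality
open import Relation.Nullary.Decidable using (Dec; yes; no; _×-dec_; _→-dec_; ¬?; decidable-stable; ¬¬-excluded-middle)
open import Relation.Nullary.Negation using (¬_; contradiction; ¬¬-map; ¬¬-Monad)

module _ {k : ℕ} where

  pair : Fin k → Fin k → Subset k
  pair x y = ⁅ x ⁆ ∪ ⁅ y ⁆

  x∈pair : ∀ x y → x ∈ pair x y
  x∈pair x y = x∈p∪q⁺ (inj₁ (x∈⁅x⁆ x))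

  y∈pair : ∀ x y → y ∈ pair x y
  y∈pair x y = x∈p∪q⁺ (inj₂ (x∈⁅x⁆ y))

  ∈pair⇒ : ∀ {x y z} → z ∈ pair x y → z ≡ x ⊎ z ≡ y
  ∈pair⇒ {x} {y} z∈ with x∈p∪q⁻ ⁅ x ⁆ ⁅ y ⁆ z∈
  ... | inj₁ z∈⁅x⁆ = inj₁ (x∈⁅y⁆⇒x≡y x z∈⁅x⁆)
  ... | inj₂ z∈⁅y⁆ = inj₂ (x∈⁅y⁆⇒x≡y y z∈⁅y⁆)

  ⁅x⁆⊆ : ∀ {x : Fin k} {p} → x ∈ p → ⁅ x ⁆ ⊆ p
  ⁅x⁆⊆ {x} {p} x∈p z∈ = subst (_∈ p) (sym (x∈⁅y⁆⇒x≡y x z∈)) x∈p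

  pair⊆ : ∀ {x y p} → x ∈ p → y ∈ p → pair x y ⊆ p
  pair⊆ x∈p y∈p z∈ with ∈pair⇒ z∈
  ... | inj₁ refl = x∈p
  ... | inj₂ refl = y∈p

  pair-comm : ∀ x y → pair x y ≡ pair y x
  pair-comm x y = ∪-comm ⁅ x ⁆ ⁅ y ⁆

  ∣⁅x⁆∣<∣pair∣ : ∀ {x y} → x ≢ y → ∣ ⁅ x ⁆ ∣ ℕ.< ∣ pair x y ∣
  ∣⁅x⁆∣<∣pair∣ {x} {y} x≢y =
    p⊂q⇒∣p∣<∣q∣ (⁅x⁆⊆ (x∈pair x y) , y , y∈pair x y , x≢y ∘ sym ∘ x∈⁅y⁆⇒x≡y x)

module _ {k : ℕ} {𝓜 : Family k} (matroid : IsMatroid 𝓜) where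
  open IsMatroid matroid

  maximal-if-extensions-dependent :
    ∀ {A X} → X ⊆ A → 𝓜 X →
    (∀ {z} → z ∈ A → z ∈ X ⊎ ∃[ x ] (x ∈ X × ¬ 𝓜 (pair x z))) →
    IsMaximalIn 𝓜 A X
  maximal-if-extensions-dependent X⊆A 𝓜X extension =
    X⊆A , 𝓜X , λ Z X⊆Z Z⊆A 𝓜Z z∈Z → [ id , (λ (x , x∈X , dependent) →
      contradiction (down _ _ (pair⊆ (X⊆Z x∈X) z∈Z) 𝓜Z) dependent) ]′ (extension (Z⊆A z∈Z))

  dependent-pair-trans : ∀ {x y z} → 𝓜 ⁅ y ⁆ → x ≢ z →
                         ¬ 𝓜 (pair x y) → ¬ 𝓜 (pair y z) → ¬ 𝓜 (pair x z)
  dependent-pair-trans {x} {y} {z} 𝓜y x≢z xy-dependent yz-dependent 𝓜xz =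
    ℕ.<-irrefl (equicard A _ _ ⁅y⁆-maximal ⁅x,z⁆-maximal) ∣⁅y⁆∣<∣⁅x,z⁆∣
    where
    A : Subset k
    A = pair x y ∪ ⁅ z ⁆

    x∈A : x ∈ A
    x∈A = x∈p∪q⁺ (inj₁ (x∈pair x y))
    y∈A : y ∈ A
    y∈A = x∈p∪q⁺ (inj₁ (y∈pair x y))
    z∈A : z ∈ A
    z∈A = x∈p∪q⁺ (inj₂ (x∈⁅x⁆ z))

    w∈A⇒ : ∀ {w} → w ∈ A → w ≡ x ⊎ w ≡ y ⊎ w ≡ z
    w∈A⇒ w∈A with x∈p∪q⁻ (pair x y) ⁅ z ⁆ w∈A
    ... | inj₁ w∈pair = map₂ inj₁ (∈pair⇒ w∈pair)
    ... | inj₂ w∈⁅z⁆   = inj₂ (inj₂ (x∈⁅y⁆⇒x≡y z w∈⁅z⁆))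

    ⁅y⁆-maximal : IsMaximalIn 𝓜 A ⁅ y ⁆
    ⁅y⁆-maximal = maximal-if-extensions-dependent (⁅x⁆⊆ y∈A) 𝓜y (extend ∘ w∈A⇒)
      where
      extend : ∀ {w} → w ≡ x ⊎ w ≡ y ⊎ w ≡ z → w ∈ ⁅ y ⁆ ⊎ ∃[ v ] (v ∈ ⁅ y ⁆ × ¬ 𝓜 (pair v w))
      extend (inj₁ refl)        = inj₂ (y , x∈⁅x⁆ y , xy-dependent ∘ subst 𝓜 (pair-comm y x))
      extend (inj₂ (inj₁ refl)) = inj₁ (x∈⁅x⁆ y)
      extend (inj₂ (inj₂ refl)) = inj₂ (y , x∈⁅x⁆ y , yz-dependent)

    ⁅x,z⁆-maximal : IsMaximalIn 𝓜 A (pair x z)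
    ⁅x,z⁆-maximal = maximal-if-extensions-dependent (pair⊆ x∈A z∈A) 𝓜xz (extend ∘ w∈A⇒)
      where
      extend : ∀ {w} → w ≡ x ⊎ w ≡ y ⊎ w ≡ z → w ∈ pair x z ⊎ ∃[ v ] (v ∈ pair x z × ¬ 𝓜 (pair v w))
      extend (inj₁ refl)        = inj₁ (x∈pair x z)
      extend (inj₂ (inj₁ refl)) = inj₂ (x , x∈pair x z , xy-dependent)
      extend (inj₂ (inj₂ refl)) = inj₁ (y∈pair x z)

    ∣⁅y⁆∣<∣⁅x,z⁆∣ : ∣ ⁅ y ⁆ ∣ ℕ.< ∣ pair x z ∣
    ∣⁅y⁆∣<∣⁅x,z⁆∣ = subst (ℕ._< ∣ pair x z ∣) (trans (∣⁅x⁆∣≡1 x) (sym (∣⁅x⁆∣≡1 y)))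
                         (∣⁅x⁆∣<∣pair∣ x≢z)

module _ {v : ℕ} (G : Graph v) where

  Joins : Fin (m G) → Fin v → Fin v → Set
  Joins e a b = tail G e ≡ a × head G e ≡ b

  joins-unique : ∀ {e f a b} → Joins e a b → Joins f a b → e ≡ f
  joins-unique {e} {f} (refl , refl) (tails , heads) = simple G e f (sym tails) (sym heads)

  joins-disjoint : ∀ {e f a b c d} → Joins e a b → Joins f c d →
                   a ≢ c → a ≢ d → b ≢ c → b ≢ d → Disjoint G e f
  joins-disjoint (refl , refl) (refl , refl) a≢c a≢d b≢c b≢d = a≢c , a≢d , b≢c , b≢d

  Disjoint⇒≢ : ∀ {e f} → Disjoint G e f → e ≢ f
  Disjoint⇒≢ (tails≢ , _) refl = tails≢ refl

  Disjoint-sym : ∀ {e f} → Disjoint G e f → Disjoint G f e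
  Disjoint-sym (t≢t , t≢h , h≢t , h≢h) = t≢t ∘ sym , h≢t ∘ sym , t≢h ∘ sym , h≢h ∘ sym

  matching-⁅x⁆ : ∀ e → Matching G ⁅ e ⁆
  matching-⁅x⁆ e x y x∈ y∈ x≢y =
    contradiction (trans (x∈⁅y⁆⇒x≡y e x∈) (sym (x∈⁅y⁆⇒x≡y e y∈))) x≢y

  matching-pair : ∀ {e f} → Disjoint G e f → Matching G (pair e f)
  matching-pair {e} {f} e∩f x y x∈ y∈ x≢y with ∈pair⇒ x∈ | ∈pair⇒ y∈
  ... | inj₁ refl | inj₁ refl = contradiction refl x≢y
  ... | inj₁ refl | inj₂ refl = e∩f
  ... | inj₂ refl | inj₁ refl = Disjoint-sym e∩f
  ... | inj₂ refl | inj₂ refl = contradiction refl x≢y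

  ¬matching-path : ∀ {e f a b c} → Joins e a b → Joins f b c → a ≢ b → ¬ Matching G (pair e f)
  ¬matching-path {e} {f} (refl , refl) (tail≡ , _) a≢b matching =
    proj₁ (proj₂ (proj₂ (matching e f (x∈pair e f) (y∈pair e f) e≢f))) (sym tail≡)
    where
    e≢f : e ≢ f
    e≢f refl = a≢b tail≡

indicator : ∀ {A : Set} → Dec A → Fin 2
indicator (yes _) = suc zero
indicator (no _)  = zero

indicator-sound : ∀ {A : Set} (A? : Dec A) → indicator A? ≡ suc zero → A
indicator-sound (yes a) _ = a

indicator-complete : ∀ {A : Set} (A? : Dec A) → A → indicator A? ≡ suc zero
indicator-complete (yes _) _  = refl
indicator-complete (no ¬a) a = contradiction a ¬a

separated⇒≤ : ∀ {n k} (W : Fin n → Fin k → Set) → (∀ c j → Dec (W c j)) →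
              (∀ {c d} → c F.< d → ∃[ j ] (W d j × ¬ W c j)) → n ≤ 2 ^ k
separated⇒≤ {n} {k} W W? separated = injective⇒≤ code-injective
  where
  code : Fin n → Fin (2 ^ k)
  code c = funToFin (λ j → indicator (W? c j))

  ordered-codes-differ : ∀ {c d} → c F.< d → code c ≢ code d
  ordered-codes-differ {c} {d} c<d codes≡ with separated c<d
  ... | j , Wdj , ¬Wcj = ¬Wcj (indicator-sound (W? c j) (begin
    indicator (W? c j) ≡⟨ finToFun-funToFin _ j ⟨
    finToFun (code c) j ≡⟨ cong (λ x → finToFun x j) codes≡ ⟩
    finToFun (code d) j ≡⟨ finToFun-funToFin _ j ⟩
    indicator (W? d j) ≡⟨ indicator-complete (W? d j) Wdj ⟩
    suc zero ∎))
    where open ≡-Reasoning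

  code-injective : Injective _≡_ _≡_ code
  code-injective {c} {d} codes≡ with <-cmp c d
  ... | tri< c<d _ _ = contradiction codes≡ (ordered-codes-differ c<d)
  ... | tri≈ _ c≡d _ = c≡d
  ... | tri> _ _ d<c = contradiction (sym codes≡) (ordered-codes-differ d<c)

module PathColouring
  {r n : ℕ} (C : Fin r → Fin n → Fin n → Fin n → Set)
  (C? : ∀ i a b c → Dec (C i a b c))
  (cover : ∀ {a b c} → a F.< b → b F.< c → ∃[ i ] C i a b c)
  (no-chain : ∀ {i a b c d} → a F.< b → b F.< c → c F.< d → C i a b c → ¬ C i b c d)
  where

  Incoming : Fin n → Fin n → Fin r → Set
  Incoming b c i = ∃[ a ] (a F.< b × C i a b c)

  incoming? : ∀ b c i → Dec (Incoming b c i)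
  incoming? b c i = any? (λ a → a <? b ×-dec C? i a b c)

  -- A set of colours is coded by a number below 2 ^ r, whose base-2 digits
  -- (finToFun) are its characteristic function.
  incoming : Fin n → Fin n → Fin (2 ^ r)
  incoming b c = funToFin (λ i → indicator (incoming? b c i))

  InDownset : Fin n → Fin (2 ^ r) → Set
  InDownset c s = ∃[ b ] (b F.< c × (∀ i → finToFun s i ≡ suc zero → Incoming b c i))

  inDownset? : ∀ c s → Dec (InDownset c s)
  inDownset? c s =
    any? (λ b → b <? c ×-dec all? (λ i → finToFun s i ≟ suc zero →-dec incoming? b c i))

  incoming∈downset : ∀ {c d} → c F.< d → InDownset d (incoming c d)
  incoming∈downset {c} {d} c<d = c , c<d , λ i digit≡1 →
    indicator-sound (incoming? c d i) (trans (sym (finToFun-funToFin _ i)) digit≡1)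

  incoming∉downset : ∀ {c d} → c F.< d → ¬ InDownset c (incoming c d)
  incoming∉downset {c} {d} c<d (b , b<c , incoming⊆) with cover b<c c<d
  ... | i , Cibcd
    with incoming⊆ i (trans (finToFun-funToFin _ i) (indicator-complete (incoming? c d i) (b , b<c , Cibcd)))
  ... | a , a<b , Ciabc = no-chain a<b b<c c<d Ciabc Cibcd

  bound : n ≤ 2 ^ (2 ^ r)
  bound = separated⇒≤ InDownset inDownset? λ c<d → _ , incoming∈downset c<d , incoming∉downset c<d

choose₂ : ℕ → ℕ
choose₂ zero    = 0
choose₂ (suc n) = n + choose₂ n

-- The edges of K (1 + n) are the n edges at vertex 0 followed by a shifted
-- copy of the edges of K n.
kTail kHead : ∀ n → Fin (choose₂ n) → Fin n
kTail (suc n) e = [ const zero , suc ∘ kTail n ]′ (splitAt n e)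
kHead (suc n) e = [ suc , suc ∘ kHead n ]′ (splitAt n e)

kTail<kHead : ∀ n e → kTail n e F.< kHead n e
kTail<kHead (suc n) e with splitAt n e
... | inj₁ j  = z<s
... | inj₂ e′ = s<s (kTail<kHead n e′)

edge : ∀ {n} {a b : Fin n} → a F.< b → Fin (choose₂ n)
edge {suc n} {zero}  {suc b} _          = b ↑ˡ choose₂ n
edge {suc n} {suc a} {suc b} (s<s a<b) = n ↑ʳ edge a<b

edge-kTail-kHead : ∀ n e → edge (kTail<kHead n e) ≡ e
edge-kTail-kHead (suc n) e with splitAt n e in eq
... | inj₁ j  = splitAt⁻¹-↑ˡ eq
... | inj₂ e′ = trans (cong (n ↑ʳ_) (edge-kTail-kHead n e′)) (splitAt⁻¹-↑ʳ eq)

kTail-edge : ∀ {n} {a b : Fin n} (a<b : a F.< b) → kTail n (edge a<b) ≡ a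
kTail-edge {suc n} {zero}  {suc b} _ rewrite splitAt-↑ˡ n b (choose₂ n) = refl
kTail-edge {suc n} {suc a} {suc b} (s<s a<b)
  rewrite splitAt-↑ʳ n (choose₂ n) (edge a<b) = cong suc (kTail-edge a<b)

kHead-edge : ∀ {n} {a b : Fin n} (a<b : a F.< b) → kHead n (edge a<b) ≡ b
kHead-edge {suc n} {zero}  {suc b} _ rewrite splitAt-↑ˡ n b (choose₂ n) = refl
kHead-edge {suc n} {suc a} {suc b} (s<s a<b)
  rewrite splitAt-↑ʳ n (choose₂ n) (edge a<b) = cong suc (kHead-edge a<b)

edge-cong : ∀ {n} {a a′ b b′ : Fin n} → a ≡ a′ → b ≡ b′ →
            (a<b : a F.< b) (a′<b′ : a′ F.< b′) → edge a<b ≡ edge a′<b′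
edge-cong refl refl a<b a′<b′ = cong edge (<-irrelevant a<b a′<b′)

kSimple : ∀ n e f → kTail n e ≡ kTail n f → kHead n e ≡ kHead n f → e ≡ f
kSimple n e f tails heads = begin
  e                      ≡⟨ edge-kTail-kHead n e ⟨
  edge (kTail<kHead n e) ≡⟨ edge-cong tails heads _ _ ⟩
  edge (kTail<kHead n f) ≡⟨ edge-kTail-kHead n f ⟩
  f                      ∎
  where open ≡-Reasoning

K : ∀ n → Graph n
K n = record
  { m = choose₂ n ; tail = kTail n ; head = kHead n
  ; ordered = kTail<kHead n ; simple = kSimple n }

edge-joins : ∀ {n} {a b : Fin n} (a<b : a F.< b) → Joins (K n) (edge a<b) a b
edge-joins a<b = kTail-edge a<b , kHead-edge a<b

¬¬-Π : ∀ {k} {P : Fin k → Set} → (∀ i → ¬ ¬ P i) → ¬ ¬ (∀ i → P i)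
¬¬-Π = sequence (RawMonad.rawApplicative ¬¬-Monad)

module MatroidCover {n r : ℕ} (I : IntersectionOf (K n) r) where

  𝓜 : Fin r → Family (choose₂ n)
  𝓜 = proj₁ I

  matching⇒independent : ∀ {X} → Matching (K n) X → ∀ i → 𝓜 i X
  matching⇒independent {X} = proj₁ (proj₂ (proj₂ I) X)

  independent⇒matching : ∀ {X} → (∀ i → 𝓜 i X) → Matching (K n) X
  independent⇒matching {X} = proj₂ (proj₂ (proj₂ I) X)

  matroid : ∀ i → IsMatroid (𝓜 i)
  matroid = proj₁ (proj₂ I)

  Rejects : Fin r → Fin n → Fin n → Fin n → Set
  Rejects i a b c = ∃[ e ] ∃[ f ] (Joins (K n) e a b × Joins (K n) f b c × ¬ 𝓜 i (pair e f))

  rejects-no-chain : ∀ {i a b c d} → a F.< b → b F.< c → c F.< d →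
                     Rejects i a b c → ¬ Rejects i b c d
  rejects-no-chain {i} a<b b<c c<d (e , f , ab , bc , ef-dependent) (f′ , g , bc′ , cd , f′g-dependent) =
    dependent-pair-trans (matroid i) (matching⇒independent (matching-⁅x⁆ (K n) f) i)
      (Disjoint⇒≢ (K n) e∩g) ef-dependent fg-dependent
      (matching⇒independent (matching-pair (K n) e∩g) i)
    where
    fg-dependent : ¬ 𝓜 i (pair f g)
    fg-dependent = subst (λ h → ¬ 𝓜 i (pair h g)) (joins-unique (K n) bc′ bc) f′g-dependent
    e∩g : Disjoint (K n) e g
    e∩g = joins-disjoint (K n) ab cd
      (<⇒≢ (F.<-trans a<b b<c)) (<⇒≢ (F.<-trans a<b (F.<-trans b<c c<d)))
      (<⇒≢ b<c) (<⇒≢ (F.<-trans b<c c<d))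

  module _ (pair? : ∀ i e f → Dec (𝓜 i (pair e f))) where

    rejects? : ∀ i a b c → Dec (Rejects i a b c)
    rejects? i a b c = any? λ e → any? λ f →
      (kTail n e ≟ a ×-dec kHead n e ≟ b) ×-dec (kTail n f ≟ b ×-dec kHead n f ≟ c) ×-dec
      ¬? (pair? i e f)

    rejects-cover : ∀ {a b c} → a F.< b → b F.< c → ∃[ i ] Rejects i a b c
    rejects-cover a<b b<c
      with ¬∀⟶∃¬ r _ (λ i → pair? i (edge a<b) (edge b<c))
             (¬matching-path (K n) (edge-joins a<b) (edge-joins b<c) (<⇒≢ a<b) ∘ independent⇒matching)
    ... | i , dependent = i , edge a<b , edge b<c , edge-joins a<b , edge-joins b<c , dependent

    decidable-bound : n ≤ 2 ^ (2 ^ r)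
    decidable-bound = PathColouring.bound Rejects rejects? rejects-cover rejects-no-chain

  -- Membership in the 𝓜 i need not be decidable, but the bound is a decidable
  -- statement, so excluded middle for the finitely many pairs may be assumed.
  bound : n ≤ 2 ^ (2 ^ r)
  bound = decidable-stable (n ℕ.≤? 2 ^ (2 ^ r))
    (¬¬-map decidable-bound (¬¬-Π λ i → ¬¬-Π λ e → ¬¬-Π λ f → ¬¬-excluded-middle))

⌊log₂⌊log₂⌋⌋-≤ : ∀ {n r} → n ≤ 2 ^ (2 ^ r) → ⌊log₂ ⌊log₂ n ⌋ ⌋ ≤ r
⌊log₂⌊log₂⌋⌋-≤ {n} {r} n≤ = begin
  ⌊log₂ ⌊log₂ n ⌋ ⌋           ≤⟨ ⌊log₂⌋-mono-≤ (⌊log₂⌋-mono-≤ n≤) ⟩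
  ⌊log₂ ⌊log₂ 2 ^ (2 ^ r) ⌋ ⌋ ≡⟨ cong ⌊log₂_⌋ (⌊log₂[2^n]⌋≡n (2 ^ r)) ⟩
  ⌊log₂ 2 ^ r ⌋               ≡⟨ ⌊log₂[2^n]⌋≡n r ⟩
  r                           ∎
  where open ℕ.≤-Reasoning

μ-K : ∀ n → μG≥ (K n) ⌊log₂ ⌊log₂ n ⌋ ⌋
μ-K n r r<k I = ℕ.<⇒≱ r<k (⌊log₂⌊log₂⌋⌋-≤ (MatroidCover.bound I))

corollary1 : ∃[ c ] ∃[ N ] (∀ n → N ≤ n → ∃[ k ] (μ≥ n k × ⌊log₂ ⌊log₂ n ⌋ ⌋ ≤ c * k))
corollary1 = 1 , 0 , λ n _ →
  ⌊log₂ ⌊log₂ n ⌋ ⌋ , (n , ℕ.≤-refl , K n , μ-K n) , ℕ.≤-reflexive (sym (ℕ.*-identityˡ _))
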